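{- Let $K_i$ be the complete graph on $[i]=\{1,\ldots,i\}$, and let $\delta=\delta_1|\cdots|\delta_k$ and $\tau=\tau_1|\cdots|\tau_k$ be two distinct $k$-partitions of $[i]$. Then there exists a $(k+1)$-partition $\sigma$ of $[i]$ such that $m_\sigma$ divides $m_\delta m_\tau$.
   Context: Work in the polynomial ring $\mathbb{K}[x_e : e\in E(K_i)]$ over a field $\mathbb{K}$, with one variable $x_{ab}$ for each edge $\{a,b\}$ of $K_i$. A $k$-partition of $[i]$ is a partition of $[i]$ into $k$ pairwise disjoint nonempty blocks. For a partition $C$, $E(C)$ is the set of edges $\{a,b\}$ of $K_i$ whose endpoints lie in different blocks of $C$, and $m_C=\prod_{e\in E(C)}x_e$. -}

module Defs where

open import Data.Nat using (ℕ; _+_)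
open import Data.Fin using (Fin; _<_)
open import Data.Product using (Σ; ∃; _×_; _,_)
open import Relation.Binary.PropositionalEquality using (_≡_)
open import Relation.Nullary using (¬_; Dec; yes; no)
open import Data.Fin using (_≟_)
open import Function.Bundles using (_⇔_)

-- A k-partition of [i] = Fin i: a surjective block-labelling Fin i → Fin k.
-- Two elements lie in the same block iff they receive the same label.
-- Surjectivity = all k blocks are nonempty.
record Partition (i k : ℕ) : Set where
  field
    block : Fin i → Fin k
    surj  : ∀ (b : Fin k) → ∃ λ (a : Fin i) → block a ≡ b
open Partition public

SamePartition : ∀ {i k l} → Partition i k → Partition i l → Set
SamePartition δ τ = ∀ a b → (block δ a ≡ block δ b) ⇔ (block τ a ≡ block τ b)

Edge : ℕ → Set
Edge i = Σ (Fin i × Fin i) λ { (a , b) → a < b }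

-- Monomials in the variables x_e (e ∈ E(K_i)) : exponent vectors.
Monomial : ℕ → Set
Monomial i = Edge i → ℕ

_·_ : ∀ {i} → Monomial i → Monomial i → Monomial i
(m · n) e = m e + n e

_∣ᵐ_ : ∀ {i} → Monomial i → Monomial i → Set
_∣ᵐ_ {i} m n = ∃ λ (q : Monomial i) → ∀ e → m e + q e ≡ n e

-- m_C = ∏_{e ∈ E(C)} x_e : exponent 1 on edges whose endpoints lie in
-- different blocks of C, exponent 0 otherwise.
m : ∀ {i k} → Partition i k → Monomial i
m C ((a , b) , _) with block C a ≟ block C b
... | yes _ = 0
... | no  _ = 1

{-# OPTIONS --safe #-}
-- If δ ≠ τ, some pair a, b shares a block of one partition but not of the
-- other, say δ. Splitting the δ-block of a into its intersection with the
-- τ-block of a and the remainder (nonempty, it contains b) gives a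
-- (k+1)-partition σ that is coarser than the common refinement of δ and τ.
-- Then every edge cut by σ is cut by δ or by τ, i.e. m σ ∣ m δ · m τ.
module Submission where

open import Defs
open import Data.Nat using (ℕ; suc; _≤_; z≤n; s≤s; _∸_)
open import Data.Nat.Properties using (m+[n∸m]≡n)
open import Data.Fin using (Fin; zero; suc; _≟_)
open import Data.Fin.Properties using (any?)
open import Data.Product using (∃; ∃₂; _×_; _,_; proj₁; proj₂)
open import Data.Sum using (_⊎_; inj₁; inj₂)
open import Relation.Nullary using (¬_; Dec; yes; no; contradiction)
open import Relation.Nullary.Decidable using (_×-dec_; _⊎-dec_; ¬?; decidable-stable)
open import Relation.Binary.PropositionalEquality using (_≡_; _≢_; refl; sym; trans; cong; cong₂)
open import Function.Bundles using (mk⇔)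

≤⇒∣ᵐ : ∀ {i} {μ ν : Monomial i} → (∀ e → μ e ≤ ν e) → μ ∣ᵐ ν
≤⇒∣ᵐ {μ = μ} {ν} μ≤ν = (λ e → ν e ∸ μ e) , λ e → m+[n∸m]≡n (μ≤ν e)

CoarsensMeet : ∀ {i k l n} → Partition i k → Partition i l → Partition i n → Set
CoarsensMeet δ τ σ =
  ∀ x y → block δ x ≡ block δ y → block τ x ≡ block τ y → block σ x ≡ block σ y

module _ {i k l n} {δ : Partition i k} {τ : Partition i l} {σ : Partition i n} where

  CoarsensMeet-sym : CoarsensMeet δ τ σ → CoarsensMeet τ δ σ
  CoarsensMeet-sym σ≥δ∧τ x y τxy δxy = σ≥δ∧τ x y δxy τxy

  coarsensMeet⇒m≤m+m : CoarsensMeet δ τ σ → ∀ e → m σ e ≤ (m δ · m τ) e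
  coarsensMeet⇒m≤m+m σ≥δ∧τ ((x , y) , _)
    with block δ x ≟ block δ y | block τ x ≟ block τ y | block σ x ≟ block σ y
  ... | _       | _       | yes _  = z≤n
  ... | yes δxy | yes τxy | no σxy = contradiction (σ≥δ∧τ x y δxy τxy) σxy
  ... | no _    | _       | no _   = s≤s z≤n
  ... | yes _   | no _    | no _   = s≤s z≤n

  coarsensMeet⇒m∣ᵐm·m : CoarsensMeet δ τ σ → m σ ∣ᵐ (m δ · m τ)
  coarsensMeet⇒m∣ᵐm·m σ≥δ∧τ = ≤⇒∣ᵐ (coarsensMeet⇒m≤m+m σ≥δ∧τ)

SplitBy : ∀ {i k l} → Partition i k → Partition i l → Fin i → Fin i → Set
SplitBy δ τ a b = block δ a ≡ block δ b × block τ a ≢ block τ b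

splitBy? : ∀ {i k l} (δ : Partition i k) (τ : Partition i l) a b → Dec (SplitBy δ τ a b)
splitBy? δ τ a b = (block δ a ≟ block δ b) ×-dec ¬? (block τ a ≟ block τ b)

¬SamePartition⇒split : ∀ {i k l} (δ : Partition i k) (τ : Partition i l) →
  ¬ SamePartition δ τ → ∃₂ λ a b → SplitBy δ τ a b ⊎ SplitBy τ δ a b
¬SamePartition⇒split δ τ δ≉τ
  with any? (λ a → any? (λ b → splitBy? δ τ a b ⊎-dec splitBy? τ δ a b))
... | yes (a , b , split) = a , b , split
... | no noSplit = contradiction same δ≉τ
  where
  same : SamePartition δ τ
  same a b = mk⇔
    (λ δab → decidable-stable (block τ a ≟ block τ b) λ τa≢b → noSplit (a , b , inj₁ (δab , τa≢b)))
    (λ τab → decidable-stable (block δ a ≟ block δ b) λ δa≢b → noSplit (a , b , inj₂ (τab , δa≢b)))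

module SplitBlock {i k l} (δ : Partition i k) (τ : Partition i l)
                  {a b : Fin i} (split : SplitBy δ τ a b) where

  private
    δab = proj₁ split
    τa≢b = proj₂ split

  label : Fin k → Fin l → Fin (suc k)
  label d t with (d ≟ block δ a) ×-dec (t ≟ block τ a)
  ... | yes _ = zero
  ... | no _  = suc d

  label-≡zero : ∀ {d t} → d ≡ block δ a → t ≡ block τ a → label d t ≡ zero
  label-≡zero {d} {t} d≡ t≡ with (d ≟ block δ a) ×-dec (t ≟ block τ a)
  ... | yes _ = refl
  ... | no ¬both = contradiction (d≡ , t≡) ¬both

  label-≡suc : ∀ {d t} → ¬ (d ≡ block δ a × t ≡ block τ a) → label d t ≡ suc d
  label-≡suc {d} {t} ¬both with (d ≟ block δ a) ×-dec (t ≟ block τ a)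
  ... | yes both = contradiction both ¬both
  ... | no _     = refl

  partition : Partition i (suc k)
  block partition x = label (block δ x) (block τ x)
  surj partition zero = a , label-≡zero refl refl
  surj partition (suc j) with j ≟ block δ a
  ... | yes j≡δa = b , trans (label-≡suc λ (_ , τba) → τa≢b (sym τba))
                             (cong suc (trans (sym δab) (sym j≡δa)))
  ... | no j≢δa with surj δ j
  ... | x , δx≡j = x , trans (label-≡suc λ (δxa , _) → j≢δa (trans (sym δx≡j) δxa))
                             (cong suc δx≡j)

  partition-coarsensMeet : CoarsensMeet δ τ partition
  partition-coarsensMeet x y δxy τxy = cong₂ label δxy τxy

mainTheorem3 : ∀ (i k : ℕ) (δ τ : Partition i k) → ¬ SamePartition δ τ →
    ∃ λ (σ : Partition i (suc k)) → m σ ∣ᵐ (m δ · m τ)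
mainTheorem3 i k δ τ δ≉τ with ¬SamePartition⇒split δ τ δ≉τ
... | _ , _ , inj₁ split = partition , coarsensMeet⇒m∣ᵐm·m partition-coarsensMeet
  where open SplitBlock δ τ split
... | _ , _ , inj₂ split =
  partition , coarsensMeet⇒m∣ᵐm·m (CoarsensMeet-sym {δ = τ} {δ} {partition} partition-coarsensMeet)
  where open SplitBlock τ δ split
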